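{- Let $m\ge 1$ and $n\ge 0$ be integers. There exist elements of $Q^2_{4m,4n+3}$ that are not a sum of three squares of elements of $Q_{4m,4n+3}$.
   Context: For positive integers $a,b$, let $Q_{a,b}=\{\alpha_0+\alpha_1\mathbf{i}+\alpha_2\mathbf{j}+\alpha_3\mathbf{k} : \alpha_0,\alpha_1,\alpha_2,\alpha_3\in\mathbb{Z}\}$ be the quaternion ring with $\mathbf{i}^2=-a$, $\mathbf{j}^2=-b$, $\mathbf{i}\mathbf{j}=-\mathbf{j}\mathbf{i}=\mathbf{k}$ (so $\mathbf{k}^2=-ab$). Let $Q_{a,b}^2$ denote the additive group generated by all squares $x^2$, $x\in Q_{a,b}$. -}

module Defs where

open import Data.Integer using (ℤ; _+_; _*_; -_; _-_; 0ℤ)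
open import Data.Nat using (ℕ)

-- Quaternion ring Q_{a,b}: elements α0 + α1 i + α2 j + α3 k with αs ∈ ℤ,
-- i² = -a, j² = -b, ij = -ji = k (so k² = -ab).
record Quat : Set where
  constructor quat
  field
    c0 c1 c2 c3 : ℤ

open Quat public

zeroQ : Quat
zeroQ = quat 0ℤ 0ℤ 0ℤ 0ℤ

addQ : Quat → Quat → Quat
addQ (quat x0 x1 x2 x3) (quat y0 y1 y2 y3) =
  quat (x0 + y0) (x1 + y1) (x2 + y2) (x3 + y3)

negQ : Quat → Quat
negQ (quat x0 x1 x2 x3) = quat (- x0) (- x1) (- x2) (- x3)

-- multiplication in Q_{a,b}, using
-- ij = k, ji = -k, ik = -a j, ki = a j, jk = b i, kj = -b i, k² = -ab
mulQ : ℤ → ℤ → Quat → Quat → Quat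
mulQ a b (quat x0 x1 x2 x3) (quat y0 y1 y2 y3) =
  quat (x0 * y0 - a * (x1 * y1) - b * (x2 * y2) - (a * b) * (x3 * y3))
       (x0 * y1 + x1 * y0 + b * (x2 * y3) - b * (x3 * y2))
       (x0 * y2 + x2 * y0 - a * (x1 * y3) + a * (x3 * y1))
       (x0 * y3 + x3 * y0 + x1 * y2 - x2 * y1)

sqQ : ℤ → ℤ → Quat → Quat
sqQ a b x = mulQ a b x x

data InSqGroup (a b : ℤ) : Quat → Set where
  sq   : (x : Quat) → InSqGroup a b (sqQ a b x)
  zero : InSqGroup a b zeroQ
  add  : {y z : Quat} → InSqGroup a b y → InSqGroup a b z → InSqGroup a b (addQ y z)
  neg  : {y : Quat} → InSqGroup a b y → InSqGroup a b (negQ y)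

SumOfThreeSquares : ℤ → ℤ → Quat → Set
SumOfThreeSquares a b y =
  ∃₃ (λ x₁ x₂ x₃ → addQ (addQ (sqQ a b x₁) (sqQ a b x₂)) (sqQ a b x₃) ≡ y)
  where
    open import Data.Product using (∃₂; Σ)
    open import Relation.Binary.PropositionalEquality using (_≡_)
    ∃₃ : (Quat → Quat → Quat → Set) → Set
    ∃₃ P = Σ Quat (λ u → ∃₂ (λ v w → P u v w))

{-# OPTIONS --safe #-}
-- The witness is 1 + 2j = (1 + j)² − j². For a quaternion x with coordinates x₀, x₁, x₂, x₃ the
-- j-coordinate of x² is exactly 2x₀x₂, and because 4 ∣ a and 4 ∣ b + 1 the sum of the 1- and
-- j-coordinates of x² is congruent to (x₀ + x₂)² mod 4. Hence if x² + y² + z² = 1 + 2j, the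
-- three integers x₀ + x₂, y₀ + y₂, z₀ + z₂ have squares summing to 3 mod 4; squares being 0 or 1
-- mod 4, all three are odd. Then every product x₀x₂, y₀y₂, z₀z₂ is even, whereas the
-- j-coordinate says that these products sum to 1.
module Submission where

open import Defs
open import Data.Empty using (⊥-elim)
open import Data.Product using (Σ; _×_; _,_)
open import Data.Sum using (_⊎_; inj₁; inj₂)
open import Function using (_∘_)
open import Relation.Nullary using (¬_)
open import Relation.Binary.PropositionalEquality
  using (_≡_; refl; sym; trans; cong; cong₂; subst; module ≡-Reasoning)

-- The integer operators are opened only inside this block: the statement below uses those of ℕ.
module _ where
  import Data.Nat as ℕ
  import Data.Nat.Divisibility as ℕ
  open import Data.Integer using (ℤ; +_; -[1+_]; _+_; _-_; _*_; -_)
  open import Data.Integer.Properties using (+-minus-telescope; +-identityˡ; *-cancelˡ-≡)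
  open import Data.Integer.DivMod using (_%ℕ_; _/ℕ_; n%ℕd<d; a≡a%ℕn+[a/ℕn]*n)
  open import Data.Integer.Divisibility.Signed
    using (_∣_; divides; ∣⇒∣ᵤ; ∣m∣n⇒∣m+n; ∣m∣n⇒∣m-n; ∣m⇒∣-m; ∣m⇒∣m*n; ∣n⇒∣m*n)
  open import Data.Integer.Tactic.RingSolver using (solve-∀)

  infix 4 _≡_mod_

  -- A record rather than a synonym for n ∣ x - y, so that x, y and n stay inferable.
  record _≡_mod_ (x y n : ℤ) : Set where
    constructor congruent
    field divides-difference : n ∣ x - y

  open _≡_mod_ using (divides-difference)

  mod-sym : ∀ {n x y} → x ≡ y mod n → y ≡ x mod n
  mod-sym {n} {x} {y} (congruent n∣x-y) =
    congruent (subst (n ∣_) (negated-difference x y) (∣m⇒∣-m n∣x-y))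
    where
    negated-difference : ∀ x y → - (x - y) ≡ y - x
    negated-difference = solve-∀

  mod-trans : ∀ {n x y z} → x ≡ y mod n → y ≡ z mod n → x ≡ z mod n
  mod-trans {n} {x} {y} {z} (congruent n∣x-y) (congruent n∣y-z) =
    congruent (subst (n ∣_) (+-minus-telescope x y z) (∣m∣n⇒∣m+n n∣x-y n∣y-z))

  mod-+ : ∀ {n x x′ y y′} → x ≡ x′ mod n → y ≡ y′ mod n → x + y ≡ x′ + y′ mod n
  mod-+ {n} {x} {x′} {y} {y′} (congruent n∣x-x′) (congruent n∣y-y′) =
    congruent (subst (n ∣_) (interchange x x′ y y′) (∣m∣n⇒∣m+n n∣x-x′ n∣y-y′))
    where
    interchange : ∀ x x′ y y′ → (x - x′) + (y - y′) ≡ (x + y) - (x′ + y′)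
    interchange = solve-∀

  Even Odd : ℤ → Set
  Even x = + 2 ∣ x
  Odd x = x ≡ + 1 mod + 2

  even⊎odd : ∀ x → Even x ⊎ Odd x
  even⊎odd x with x %ℕ 2 | n%ℕd<d x 2 | a≡a%ℕn+[a/ℕn]*n x 2
  ... | 0 | _ | x≡2q = inj₁ (divides (x /ℕ 2) (subst (x ≡_) (+-identityˡ _) x≡2q))
  ... | 1 | _ | x≡1+2q =
    inj₂ (congruent (divides (x /ℕ 2) (subst (λ w → w - + 1 ≡ x /ℕ 2 * + 2) (sym x≡1+2q) (cancel (x /ℕ 2)))))
    where
    cancel : ∀ q → (+ 1 + q * + 2) - + 1 ≡ q * + 2
    cancel = solve-∀
  ... | ℕ.suc (ℕ.suc _) | ℕ.s≤s (ℕ.s≤s ()) | _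

  ¬even-1 : ¬ Even (+ 1)
  ¬even-1 = ℕ.>⇒∤ (ℕ.s<s ℕ.z<s) ∘ ∣⇒∣ᵤ

  even-square : ∀ {x} → Even x → x * x ≡ + 0 mod + 4
  even-square (divides k refl) = congruent (divides (k * k) (identity k))
    where
    identity : ∀ k → k * + 2 * (k * + 2) - + 0 ≡ k * k * + 4
    identity = solve-∀

  odd-square : ∀ {x} → Odd x → x * x ≡ + 1 mod + 4
  odd-square {x} (congruent (divides k x-1≡2k)) = congruent (divides (k * k + k) (begin
    x * x - + 1                      ≡⟨ factor x ⟩
    (x - + 1) * ((x - + 1) + + 2)    ≡⟨ cong (λ d → d * (d + + 2)) x-1≡2k ⟩
    k * + 2 * (k * + 2 + + 2)        ≡⟨ expand k ⟩
    (k * k + k) * + 4                ∎))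
    where
    open ≡-Reasoning
    factor : ∀ x → x * x - + 1 ≡ (x - + 1) * ((x - + 1) + + 2)
    factor = solve-∀
    expand : ∀ k → k * + 2 * (k * + 2 + + 2) ≡ (k * k + k) * + 4
    expand = solve-∀

  odd-sum⇒even-product : ∀ x y → Odd (x + y) → Even (x * y)
  odd-sum⇒even-product x y (congruent 2∣x+y-1) with even⊎odd x
  ... | inj₁ x-even = ∣m⇒∣m*n y x-even
  ... | inj₂ (congruent 2∣x-1) = ∣n⇒∣m*n x (subst (+ 2 ∣_) (cancel x y) (∣m∣n⇒∣m-n 2∣x+y-1 2∣x-1))
    where
    cancel : ∀ x y → (x + y - + 1) - (x - + 1) ≡ y
    cancel = solve-∀

  square-residue : ∀ {x} → Even x ⊎ Odd x → ℤ
  square-residue (inj₁ _) = + 0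
  square-residue (inj₂ _) = + 1

  ≡-square-residue : ∀ {x} (p : Even x ⊎ Odd x) → x * x ≡ square-residue p mod + 4
  ≡-square-residue (inj₁ x-even) = even-square x-even
  ≡-square-residue (inj₂ x-odd) = odd-square x-odd

  4∤-[1+_] : ∀ {k} → k ℕ.< 3 → ¬ + 4 ∣ -[1+ k ]
  4∤-[1+ k<3 ] = ℕ.>⇒∤ (ℕ.s<s k<3) ∘ ∣⇒∣ᵤ

  three-squares≡3⇒odd : ∀ x y z → x * x + y * y + z * z ≡ + 3 mod + 4 → Odd x × Odd y × Odd z
  three-squares≡3⇒odd x y z sum≡3 = all-odd (even⊎odd x) (even⊎odd y) (even⊎odd z)
    where
    4∣residues-3 : (px : Even x ⊎ Odd x) (py : Even y ⊎ Odd y) (pz : Even z ⊎ Odd z) →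
      + 4 ∣ square-residue px + square-residue py + square-residue pz - + 3
    4∣residues-3 px py pz = divides-difference (mod-trans
      (mod-sym (mod-+ (mod-+ (≡-square-residue px) (≡-square-residue py)) (≡-square-residue pz))) sum≡3)

    all-odd : (px : Even x ⊎ Odd x) (py : Even y ⊎ Odd y) (pz : Even z ⊎ Odd z) → Odd x × Odd y × Odd z
    all-odd (inj₂ ox) (inj₂ oy) (inj₂ oz) = ox , oy , oz
    all-odd px@(inj₁ _) py@(inj₁ _) pz@(inj₁ _) = ⊥-elim (4∤-[1+ ℕ.s<s (ℕ.s<s ℕ.z<s) ] (4∣residues-3 px py pz))
    all-odd px@(inj₁ _) py@(inj₁ _) pz@(inj₂ _) = ⊥-elim (4∤-[1+ ℕ.s<s ℕ.z<s ] (4∣residues-3 px py pz))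
    all-odd px@(inj₁ _) py@(inj₂ _) pz@(inj₁ _) = ⊥-elim (4∤-[1+ ℕ.s<s ℕ.z<s ] (4∣residues-3 px py pz))
    all-odd px@(inj₂ _) py@(inj₁ _) pz@(inj₁ _) = ⊥-elim (4∤-[1+ ℕ.s<s ℕ.z<s ] (4∣residues-3 px py pz))
    all-odd px@(inj₁ _) py@(inj₂ _) pz@(inj₂ _) = ⊥-elim (4∤-[1+ ℕ.z<s ] (4∣residues-3 px py pz))
    all-odd px@(inj₂ _) py@(inj₁ _) pz@(inj₂ _) = ⊥-elim (4∤-[1+ ℕ.z<s ] (4∣residues-3 px py pz))
    all-odd px@(inj₂ _) py@(inj₂ _) pz@(inj₁ _) = ⊥-elim (4∤-[1+ ℕ.z<s ] (4∣residues-3 px py pz))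

  sum-of-products-even : ∀ p₁ q₁ p₂ q₂ p₃ q₃ →
    (p₁ + q₁) * (p₁ + q₁) + (p₂ + q₂) * (p₂ + q₂) + (p₃ + q₃) * (p₃ + q₃) ≡ + 3 mod + 4 →
    Even (p₁ * q₁ + p₂ * q₂ + p₃ * q₃)
  sum-of-products-even p₁ q₁ p₂ q₂ p₃ q₃ sum≡3
    with three-squares≡3⇒odd (p₁ + q₁) (p₂ + q₂) (p₃ + q₃) sum≡3
  ... | odd₁ , odd₂ , odd₃ = ∣m∣n⇒∣m+n (∣m∣n⇒∣m+n (odd-sum⇒even-product p₁ q₁ odd₁)
    (odd-sum⇒even-product p₂ q₂ odd₂)) (odd-sum⇒even-product p₃ q₃ odd₃)

  quat-≡ : ∀ {x₀ x₁ x₂ x₃ y₀ y₁ y₂ y₃} →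
    x₀ ≡ y₀ → x₁ ≡ y₁ → x₂ ≡ y₂ → x₃ ≡ y₃ → quat x₀ x₁ x₂ x₃ ≡ quat y₀ y₁ y₂ y₃
  quat-≡ refl refl refl refl = refl

  c2-sqQ : ∀ a b x → c2 (sqQ a b x) ≡ + 2 * (c0 x * c2 x)
  c2-sqQ a b x = identity a (c0 x) (c1 x) (c2 x) (c3 x)
    where
    identity : ∀ a x₀ x₁ x₂ x₃ → x₀ * x₂ + x₂ * x₀ - a * (x₁ * x₃) + a * (x₃ * x₁) ≡ + 2 * (x₀ * x₂)
    identity = solve-∀

  sqQ-s+tj : ∀ a b s t → sqQ a b (quat s (+ 0) t (+ 0)) ≡ quat (s * s - b * (t * t)) (+ 0) (+ 2 * (s * t)) (+ 0)
  sqQ-s+tj a b s t =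
    quat-≡ (identity₀ a b s t) (identity₁ b s t) (c2-sqQ a b (quat s (+ 0) t (+ 0))) (identity₃ s t)
    where
    identity₀ : ∀ a b s t → s * s - a * + 0 - b * (t * t) - a * b * + 0 ≡ s * s - b * (t * t)
    identity₀ = solve-∀
    identity₁ : ∀ b s t → s * + 0 + + 0 * s + b * (t * + 0) - b * (+ 0 * t) ≡ + 0
    identity₁ = solve-∀
    identity₃ : ∀ s t → s * + 0 + + 0 * s + + 0 * t - t * + 0 ≡ + 0
    identity₃ = solve-∀

  1+2j : Quat
  1+2j = quat (+ 1) (+ 0) (+ 2) (+ 0)

  1+2j∈Q² : ∀ a b → InSqGroup a b 1+2j
  1+2j∈Q² a b = subst (InSqGroup a b) [1+j]²-j²≡1+2j (add (sq 1+j) (neg (sq j)))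
    where
    1+j j : Quat
    1+j = quat (+ 1) (+ 0) (+ 1) (+ 0)
    j = quat (+ 0) (+ 0) (+ 1) (+ 0)
    real-part : ∀ b → (+ 1 - b * + 1) - (+ 0 - b * + 1) ≡ + 1
    real-part = solve-∀
    open ≡-Reasoning
    [1+j]²-j²≡1+2j : addQ (sqQ a b 1+j) (negQ (sqQ a b j)) ≡ 1+2j
    [1+j]²-j²≡1+2j = begin
      addQ (sqQ a b 1+j) (negQ (sqQ a b j))
        ≡⟨ cong₂ (λ p q → addQ p (negQ q)) (sqQ-s+tj a b (+ 1) (+ 1)) (sqQ-s+tj a b (+ 0) (+ 1)) ⟩
      quat ((+ 1 - b * + 1) - (+ 0 - b * + 1)) (+ 0) (+ 2) (+ 0)
        ≡⟨ cong (λ r → quat r (+ 0) (+ 2) (+ 0)) (real-part b) ⟩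
      1+2j ∎

  c0+c2 : Quat → ℤ
  c0+c2 x = c0 x + c2 x

  c0+c2-addQ : ∀ x y → c0+c2 (addQ x y) ≡ c0+c2 x + c0+c2 y
  c0+c2-addQ x y = interchange (c0 x) (c0 y) (c2 x) (c2 y)
    where
    interchange : ∀ x₀ y₀ x₂ y₂ → (x₀ + y₀) + (x₂ + y₂) ≡ (x₀ + x₂) + (y₀ + y₂)
    interchange = solve-∀

  module _ {a b : ℤ} (4∣a : + 4 ∣ a) (4∣b+1 : + 4 ∣ b + + 1) where

    c0+c2-sqQ : ∀ x → c0+c2 (sqQ a b x) ≡ c0+c2 x * c0+c2 x mod + 4
    c0+c2-sqQ x = congruent (subst (+ 4 ∣_) (sym (identity a b (c0 x) (c1 x) (c2 x) (c3 x)))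
      (∣m⇒∣-m (∣m∣n⇒∣m+n (∣m∣n⇒∣m+n (∣m⇒∣m*n _ 4∣a) (∣m⇒∣m*n _ 4∣b+1)) (∣m⇒∣m*n _ 4∣a))))
      where
      identity : ∀ a b x₀ x₁ x₂ x₃ →
        ((x₀ * x₀ - a * (x₁ * x₁) - b * (x₂ * x₂) - a * b * (x₃ * x₃))
          + (x₀ * x₂ + x₂ * x₀ - a * (x₁ * x₃) + a * (x₃ * x₁)))
        - (x₀ + x₂) * (x₀ + x₂)
        ≡ - (a * (x₁ * x₁) + (b + + 1) * (x₂ * x₂) + a * (b * (x₃ * x₃)))
      identity = solve-∀

    ¬SumOfThreeSquares-1+2j : ¬ SumOfThreeSquares a b 1+2j
    ¬SumOfThreeSquares-1+2j (x , y , z , x²+y²+z²≡1+2j) =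
      ¬even-1 (subst Even Σx₀x₂≡1 (sum-of-products-even (c0 x) (c2 x) (c0 y) (c2 y) (c0 z) (c2 z) Σ≡3))
      where
      open ≡-Reasoning
      Σ≡3 : c0+c2 x * c0+c2 x + c0+c2 y * c0+c2 y + c0+c2 z * c0+c2 z ≡ + 3 mod + 4
      Σ≡3 = subst (λ s → _ ≡ s mod + 4) (begin
        c0+c2 (sqQ a b x) + c0+c2 (sqQ a b y) + c0+c2 (sqQ a b z)
          ≡⟨ cong (_+ c0+c2 (sqQ a b z)) (c0+c2-addQ (sqQ a b x) (sqQ a b y)) ⟨
        c0+c2 (addQ (sqQ a b x) (sqQ a b y)) + c0+c2 (sqQ a b z)
          ≡⟨ c0+c2-addQ (addQ (sqQ a b x) (sqQ a b y)) (sqQ a b z) ⟨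
        c0+c2 (addQ (addQ (sqQ a b x) (sqQ a b y)) (sqQ a b z))
          ≡⟨ cong c0+c2 x²+y²+z²≡1+2j ⟩
        + 3 ∎)
        (mod-sym (mod-+ (mod-+ (c0+c2-sqQ x) (c0+c2-sqQ y)) (c0+c2-sqQ z)))
      Σx₀x₂≡1 : c0 x * c2 x + c0 y * c2 y + c0 z * c2 z ≡ + 1
      Σx₀x₂≡1 = *-cancelˡ-≡ (+ 2) _ _ (begin
        + 2 * (c0 x * c2 x + c0 y * c2 y + c0 z * c2 z)
          ≡⟨ distrib (c0 x * c2 x) (c0 y * c2 y) (c0 z * c2 z) ⟩
        + 2 * (c0 x * c2 x) + + 2 * (c0 y * c2 y) + + 2 * (c0 z * c2 z)
          ≡⟨ cong₂ _+_ (cong₂ _+_ (c2-sqQ a b x) (c2-sqQ a b y)) (c2-sqQ a b z) ⟨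
        c2 (addQ (addQ (sqQ a b x) (sqQ a b y)) (sqQ a b z))
          ≡⟨ cong c2 x²+y²+z²≡1+2j ⟩
        + 2 ∎)
        where
        distrib : ∀ p q r → + 2 * (p + q + r) ≡ + 2 * p + + 2 * q + + 2 * r
        distrib = solve-∀

open import Data.Nat using (ℕ; _*_; _+_; _≤_)
open import Data.Nat.Properties using (*-comm; +-assoc; +-comm)
open import Data.Integer as ℤ using (+_)
open import Data.Integer.Properties using (pos-*)
open import Data.Integer.Divisibility.Signed using (_∣_; divides)

mainTheorem5 : (m n : ℕ) → 1 ≤ m →
    Σ Quat (λ y → InSqGroup (+ (4 * m)) (+ (4 * n + 3)) y
                × ¬ SumOfThreeSquares (+ (4 * m)) (+ (4 * n + 3)) y)
mainTheorem5 m n _ = 1+2j , 1+2j∈Q² _ _ , ¬SumOfThreeSquares-1+2j 4∣4m 4∣[4n+3]+1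
  where
  4n+3+1≡[1+n]*4 : 4 * n + 3 + 1 ≡ (1 + n) * 4
  4n+3+1≡[1+n]*4 = trans (+-assoc (4 * n) 3 1) (trans (+-comm (4 * n) 4) (cong (λ k → 4 + k) (*-comm 4 n)))
  4∣4m : + 4 ∣ + (4 * m)
  4∣4m = divides (+ m) (trans (cong +_ (*-comm 4 m)) (pos-* m 4))
  4∣[4n+3]+1 : + 4 ∣ + (4 * n + 3) ℤ.+ + 1
  4∣[4n+3]+1 = divides (+ (1 + n)) (trans (cong +_ 4n+3+1≡[1+n]*4) (pos-* (1 + n) 4))
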